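{- (Soundness) For every formula $\phi$ of LEL, if $\vdash\phi$ then $\phi$ is valid in every model of LEL, i.e. $V(\phi)=1$ for every lattice effect algebra $E$ and every valuation $V:P\to E$.
   Context: Let $P$ be a set of atomic propositions. Formulas of LEL are given by $\phi::= p\mid\bot\mid\phi\rightarrow\phi$ with $p\in P$. Abbreviations: $\neg\phi:=\phi\rightarrow\bot$; $\top:=\neg\bot$; $\phi\mathbin{\dot\wedge}\psi:=\neg(\phi\rightarrow\neg\psi)$; $\phi\wedge\psi:=\phi\mathbin{\dot\wedge}(\phi\rightarrow\psi)$. "$\vdash\phi\leftrightarrow\psi$" abbreviates "$\vdash\phi\rightarrow\psi$ and $\vdash\psi\rightarrow\phi$". The provable formulas ($\vdash\phi$) form the least set containing all instances of the axiom schemata and closed under the rules below (rules with "iff" apply in both directions): Axioms: (A1) $\vdash\phi\rightarrow\phi$; (A2) $\vdash\phi\leftrightarrow\neg\neg\phi$; (A3) $\vdash\phi\rightarrow\top$; (A4) $\vdash\phi\wedge\psi\rightarrow\phi$; (A5) $\vdash\phi\wedge\psi\rightarrow\psi$. Rules: (R1) $\vdash\phi$ iff $\vdash\top\rightarrow\phi$; (R2) $\vdash\phi\rightarrow\psi$ and $\vdash\psi\rightarrow\chi$ imply $\vdash\phi\rightarrow\chi$; (R3) $\vdash\phi\rightarrow\psi$ implies $\vdash\neg\psi\rightarrow\neg\phi$; (R4) $\vdash\phi\rightarrow\psi$ implies $\vdash(\neg\phi\rightarrow\psi)\leftrightarrow(\neg\psi\rightarrow\phi)$; (R5) $\vdash\phi\rightarrow\psi$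 implies $\vdash\phi\rightarrow(\neg\phi\rightarrow\psi)$; (R6) $\vdash\phi\rightarrow\psi$ implies $\vdash\chi\mathbin{\dot\wedge}\phi\rightarrow\chi\mathbin{\dot\wedge}\psi$; (R7) $\vdash\phi\leftrightarrow\psi$ implies $\vdash\phi\mathbin{\dot\wedge}\chi\leftrightarrow\psi\mathbin{\dot\wedge}\chi$; (R8) $\vdash\phi\rightarrow\psi$ and $\vdash\phi\rightarrow\chi$ imply $\vdash\phi\rightarrow\psi\wedge\chi$; (R9) $\vdash\phi\rightarrow\neg\psi$, $\vdash\phi\rightarrow\neg\chi$ and $\vdash(\neg\phi\rightarrow\psi)\rightarrow\neg\chi$ imply $\vdash(\neg\phi\rightarrow\chi)\rightarrow\neg\psi$; (R10) $\vdash\neg\psi\rightarrow\chi$ and $\vdash\neg\phi\rightarrow\psi\mathbin{\dot\wedge}\chi$ imply $\vdash\phi\mathbin{\dot\wedge}(\psi\mathbin{\dot\wedge}\chi)\leftrightarrow(\phi\mathbin{\dot\wedge}\psi)\mathbin{\dot\wedge}\chi$. Semantics: an effect algebra is $(E;\oplus,0,1)$ with $\oplus$ partial such that (E1) $a\oplus b$ defined implies $b\oplus a$ defined and equal; (E2) if $b\oplus c$ and $a\oplus(b\oplus c)$ are defined then $a\oplus b$, $(a\oplus b)\oplus c$ are defined and $a\oplus(b\oplus c)=(a\oplus b)\oplus c$; (E3) each $a$ has a unique $a'$ with $a\oplus a'=1$; (E4) $a\oplus 1$ defined implies $a=0$. With $a\leq b$ iff $a\oplus c=b$ for some $c$, a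 lattice effect algebra is one where $\leq$ is a lattice order (meet $\wedge$). Sasaki arrow: $a\rightarrow_s b:=a'\oplus(a\wedge b)$. A model is a pair $\langle E,V\rangle$ with $E$ a lattice effect algebra and $V:P\to E$, extended by $V(\bot)=0$ and $V(\phi\rightarrow\psi)=V(\phi)\rightarrow_s V(\psi)$. A formula $\phi$ is valid in $\langle E,V\rangle$ if $V(\phi)=1$. -}

module Defs where

open import Level using (Level; suc; _⊔_)
open import Data.Maybe using (Maybe; just; nothing; _>>=_)
open import Data.Product using (Σ; _×_; _,_)
open import Relation.Binary.PropositionalEquality using (_≡_)

data Formula {p : Level} (P : Set p) : Set p where
  atom : P → Formula P
  ⊥f   : Formula P
  _⇒_  : Formula P → Formula P → Formula P

infixr 5 _⇒_
module _ {p : Level} {P : Set p} where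

  infix 7 _∧̇_ _∧f_
  infix 8 ¬f_

  ¬f_ : Formula P → Formula P
  ¬f φ = φ ⇒ ⊥f

  ⊤f : Formula P
  ⊤f = ¬f ⊥f

  _∧̇_ : Formula P → Formula P → Formula P
  φ ∧̇ ψ = ¬f (φ ⇒ ¬f ψ)

  _∧f_ : Formula P → Formula P → Formula P
  φ ∧f ψ = φ ∧̇ (φ ⇒ ψ)

-- Provability: the least set closed under axioms (A1)-(A5) and rules
-- (R1)-(R10).  "⊢ φ ↔ ψ" in a conclusion is rendered by two
-- constructors (one per direction); in a hypothesis by two premises.

infix 3 ⊢_

data ⊢_ {p : Level} {P : Set p} : Formula P → Set p where
  A1  : ∀ φ → ⊢ φ ⇒ φ
  A2a : ∀ φ → ⊢ φ ⇒ ¬f ¬f φ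
  A2b : ∀ φ → ⊢ ¬f ¬f φ ⇒ φ
  A3  : ∀ φ → ⊢ φ ⇒ ⊤f
  A4  : ∀ φ ψ → ⊢ φ ∧f ψ ⇒ φ
  A5  : ∀ φ ψ → ⊢ φ ∧f ψ ⇒ ψ
  R1a : ∀ {φ} → ⊢ φ → ⊢ ⊤f ⇒ φ
  R1b : ∀ {φ} → ⊢ ⊤f ⇒ φ → ⊢ φ
  R2  : ∀ {φ ψ χ} → ⊢ φ ⇒ ψ → ⊢ ψ ⇒ χ → ⊢ φ ⇒ χ
  R3  : ∀ {φ ψ} → ⊢ φ ⇒ ψ → ⊢ ¬f ψ ⇒ ¬f φ
  R4a : ∀ {φ ψ} → ⊢ φ ⇒ ψ → ⊢ (¬f φ ⇒ ψ) ⇒ (¬f ψ ⇒ φ)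
  R4b : ∀ {φ ψ} → ⊢ φ ⇒ ψ → ⊢ (¬f ψ ⇒ φ) ⇒ (¬f φ ⇒ ψ)
  R5  : ∀ {φ ψ} → ⊢ φ ⇒ ψ → ⊢ φ ⇒ (¬f φ ⇒ ψ)
  R6  : ∀ {φ ψ} χ → ⊢ φ ⇒ ψ → ⊢ χ ∧̇ φ ⇒ χ ∧̇ ψ
  R7a : ∀ {φ ψ} χ → ⊢ φ ⇒ ψ → ⊢ ψ ⇒ φ → ⊢ φ ∧̇ χ ⇒ ψ ∧̇ χ
  R7b : ∀ {φ ψ} χ → ⊢ φ ⇒ ψ → ⊢ ψ ⇒ φ → ⊢ ψ ∧̇ χ ⇒ φ ∧̇ χ
  R8  : ∀ {φ ψ χ} → ⊢ φ ⇒ ψ → ⊢ φ ⇒ χ → ⊢ φ ⇒ ψ ∧f χ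
  R9  : ∀ {φ ψ χ} → ⊢ φ ⇒ ¬f ψ → ⊢ φ ⇒ ¬f χ → ⊢ (¬f φ ⇒ ψ) ⇒ ¬f χ
        → ⊢ (¬f φ ⇒ χ) ⇒ ¬f ψ
  R10a : ∀ {φ ψ χ} → ⊢ ¬f ψ ⇒ χ → ⊢ ¬f φ ⇒ ψ ∧̇ χ
         → ⊢ φ ∧̇ (ψ ∧̇ χ) ⇒ (φ ∧̇ ψ) ∧̇ χ
  R10b : ∀ {φ ψ χ} → ⊢ ¬f ψ ⇒ χ → ⊢ ¬f φ ⇒ ψ ∧̇ χ
         → ⊢ (φ ∧̇ ψ) ∧̇ χ ⇒ φ ∧̇ (ψ ∧̇ χ)

-- Effect algebras.  The partial operation ⊕ is a function into Maybe:
-- "a ⊕ b defined and equal to c" is  a ⊕ b ≡ just c.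

record EffectAlgebra (ℓ : Level) : Set (suc ℓ) where
  infixl 6 _⊕_
  field
    Carrier : Set ℓ
    _⊕_     : Carrier → Carrier → Maybe Carrier
    𝟘 𝟙     : Carrier
    comm    : ∀ a b c → a ⊕ b ≡ just c → b ⊕ a ≡ just c
    assoc   : ∀ a b c bc abc → b ⊕ c ≡ just bc → a ⊕ bc ≡ just abc →
              Σ Carrier λ ab → (a ⊕ b ≡ just ab) × (ab ⊕ c ≡ just abc)
    _′      : Carrier → Carrier
    ′-sum   : ∀ a → a ⊕ (a ′) ≡ just 𝟙
    ′-unique : ∀ a b → a ⊕ b ≡ just 𝟙 → b ≡ a ′
    zero-one : ∀ a c → a ⊕ 𝟙 ≡ just c → a ≡ 𝟘

  _≤_ : Carrier → Carrier → Set ℓ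
  a ≤ b = Σ Carrier λ c → a ⊕ c ≡ just b

record LatticeEffectAlgebra (ℓ : Level) : Set (suc ℓ) where
  field
    effectAlgebra : EffectAlgebra ℓ
  open EffectAlgebra effectAlgebra public
  field
    _⊓_   : Carrier → Carrier → Carrier
    ⊓-lb₁ : ∀ a b → (a ⊓ b) ≤ a
    ⊓-lb₂ : ∀ a b → (a ⊓ b) ≤ b
    ⊓-glb : ∀ a b c → c ≤ a → c ≤ b → c ≤ (a ⊓ b)
    _⊔ₗ_  : Carrier → Carrier → Carrier
    ⊔-ub₁ : ∀ a b → a ≤ (a ⊔ₗ b)
    ⊔-ub₂ : ∀ a b → b ≤ (a ⊔ₗ b)
    ⊔-lub : ∀ a b c → a ≤ c → b ≤ c → (a ⊔ₗ b) ≤ c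

  -- Sasaki arrow a →s b = a′ ⊕ (a ∧ b)  (as a partial operation; it is
  -- in fact always defined)
  _→s_ : Carrier → Carrier → Maybe Carrier
  a →s b = (a ′) ⊕ (a ⊓ b)

module _ {ℓ p : Level} {P : Set p} (E : LatticeEffectAlgebra ℓ) where
  open LatticeEffectAlgebra E

  ⟦_⟧ : Formula P → (P → Carrier) → Maybe Carrier
  ⟦ atom x ⟧ V = just (V x)
  ⟦ ⊥f ⟧     V = just 𝟘
  ⟦ φ ⇒ ψ ⟧  V = ⟦ φ ⟧ V >>= λ a → ⟦ ψ ⟧ V >>= λ b → a →s b

  ValidIn : Formula P → (P → Carrier) → Set ℓ
  ValidIn φ V = ⟦ φ ⟧ V ≡ just 𝟙

-- Every theorem of LEL evaluates to 𝟙.  Since a →s b = 𝟙 exactly when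
-- a ≤ b, each axiom and rule becomes an order-theoretic statement about
-- the Sasaki arrow, and these statements are proved one by one.

module Submission where

open import Defs
open import Level using (Level)
open import Data.Maybe using (just)
open import Data.Maybe.Properties using (just-injective)
open import Data.Product using (Σ; _×_; _,_; proj₁; proj₂)
open import Relation.Binary.PropositionalEquality
  using (_≡_; refl; sym; trans; cong; subst; subst₂; module ≡-Reasoning)

module EffectAlgebraProperties {ℓ : Level} (E : EffectAlgebra ℓ) where
  open EffectAlgebra E

  infix 4 _⊕_↦_

  _⊕_↦_ : Carrier → Carrier → Carrier → Set ℓ
  a ⊕ b ↦ c = a ⊕ b ≡ just c

  private
    variable
      a b c d x y s ab bc abc dx dy : Carrier

  ⊕-functional : a ⊕ b ↦ c → a ⊕ b ↦ d → c ≡ d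
  ⊕-functional p q = just-injective (trans (sym p) q)

  ⊕-comm : a ⊕ b ↦ c → b ⊕ a ↦ c
  ⊕-comm = comm _ _ _

  ⊕-assocˡ : b ⊕ c ↦ bc → a ⊕ bc ↦ abc →
             Σ Carrier λ ab → a ⊕ b ↦ ab × ab ⊕ c ↦ abc
  ⊕-assocˡ = assoc _ _ _ _ _

  ⊕-assocʳ : a ⊕ b ↦ ab → ab ⊕ c ↦ abc →
             Σ Carrier λ bc → b ⊕ c ↦ bc × a ⊕ bc ↦ abc
  ⊕-assocʳ p q with ⊕-assocˡ p (⊕-comm q)
  ... | ca , c⊕a , ca⊕b with ⊕-assocˡ c⊕a (⊕-comm ca⊕b)
  ... | bc , b⊕c , bc⊕a = bc , b⊕c , ⊕-comm bc⊕a

  ′-involutive : ∀ a → a ′ ′ ≡ a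
  ′-involutive a = sym (′-unique (a ′) a (⊕-comm (′-sum a)))

  𝟙′≡𝟘 : 𝟙 ′ ≡ 𝟘
  𝟙′≡𝟘 = zero-one (𝟙 ′) 𝟙 (⊕-comm (′-sum 𝟙))

  𝟘′≡𝟙 : 𝟘 ′ ≡ 𝟙
  𝟘′≡𝟙 = trans (cong _′ (sym 𝟙′≡𝟘)) (′-involutive 𝟙)

  𝟘⊕𝟙 : 𝟘 ⊕ 𝟙 ↦ 𝟙
  𝟘⊕𝟙 = subst (λ z → z ⊕ 𝟙 ↦ 𝟙) 𝟙′≡𝟘 (⊕-comm (′-sum 𝟙))

  -- 𝟘 is neutral: 𝟘 ⊕ a ⊕ a′ = 𝟙 forces 𝟘 ⊕ a to be the complement of a′.
  ⊕-identityˡ : ∀ a → 𝟘 ⊕ a ↦ a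
  ⊕-identityˡ a with ⊕-assocˡ (′-sum a) 𝟘⊕𝟙
  ... | x , 𝟘⊕a , x⊕a′ = subst (𝟘 ⊕ a ↦_) x≡a 𝟘⊕a
    where
    x≡a : x ≡ a
    x≡a = begin
      x          ≡⟨ sym (′-involutive x) ⟩
      x ′ ′      ≡⟨ cong _′ (sym (′-unique x (a ′) x⊕a′)) ⟩
      a ′ ′      ≡⟨ ′-involutive a ⟩
      a          ∎
      where open ≡-Reasoning

  ⊕-identityʳ : ∀ a → a ⊕ 𝟘 ↦ a
  ⊕-identityʳ a = ⊕-comm (⊕-identityˡ a)

  ⊕-complement : a ⊕ b ↦ s → b ⊕ s ′ ↦ a ′
  ⊕-complement {a} {b} {s} p with ⊕-assocʳ p (′-sum s)
  ... | x , b⊕s′ , a⊕x = subst (b ⊕ s ′ ↦_) (′-unique a x a⊕x) b⊕s′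

  -- Applying ⊕-complement twice gives s′ ⊕ a = b′, so b is determined.
  ⊕-cancelˡ : a ⊕ b ↦ s → a ⊕ c ↦ s → b ≡ c
  ⊕-cancelˡ {a} {b} {s} {c} p q = begin
    b           ≡⟨ sym (′-involutive b) ⟩
    b ′ ′       ≡⟨ cong _′ (⊕-functional (dual p) (dual q)) ⟩
    c ′ ′       ≡⟨ ′-involutive c ⟩
    c           ∎
    where
    open ≡-Reasoning
    dual : ∀ {y} → a ⊕ y ↦ s → s ′ ⊕ a ↦ y ′
    dual {y} r = subst (λ z → s ′ ⊕ z ↦ y ′) (′-involutive a)
                   (⊕-complement (⊕-complement r))

  -- Positivity: a ⊕ b = 𝟘 forces a = 𝟘, via b ⊕ 𝟙 and (E4).
  ⊕-positive : a ⊕ b ↦ 𝟘 → a ≡ 𝟘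
  ⊕-positive {a} {b} p with ⊕-assocʳ p 𝟘⊕𝟙
  ... | y , b⊕𝟙 , a⊕y = zero-one a 𝟙 (subst (a ⊕_↦ 𝟙) y≡𝟙 a⊕y)
    where
    y≡𝟙 : y ≡ 𝟙
    y≡𝟙 = ⊕-functional (subst (_⊕ 𝟙 ↦ y) (zero-one b y b⊕𝟙) b⊕𝟙)
                       (⊕-identityˡ 𝟙)

  ≤-refl : a ≤ a
  ≤-refl {a} = 𝟘 , ⊕-identityʳ a

  ≡⇒≤ : a ≡ b → a ≤ b
  ≡⇒≤ refl = ≤-refl

  ≤-trans : a ≤ b → b ≤ c → a ≤ c
  ≤-trans (x , a⊕x) (y , b⊕y) with ⊕-assocʳ a⊕x b⊕y
  ... | xy , _ , a⊕xy = xy , a⊕xy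

  -- a ⊕ x ⊕ y = a forces x ⊕ y = 𝟘 by cancellation, hence x = 𝟘.
  ≤-antisym : a ≤ b → b ≤ a → a ≡ b
  ≤-antisym {a} {b} (x , a⊕x) (y , b⊕y) with ⊕-assocʳ a⊕x b⊕y
  ... | xy , x⊕y , a⊕xy =
    ⊕-functional (⊕-identityʳ a) (subst (λ z → a ⊕ z ↦ b) x≡𝟘 a⊕x)
    where
    x≡𝟘 : x ≡ 𝟘
    x≡𝟘 = ⊕-positive (subst (x ⊕ y ↦_) (⊕-cancelˡ a⊕xy (⊕-identityʳ a)) x⊕y)

  𝟘≤ : 𝟘 ≤ a
  𝟘≤ {a} = a , ⊕-identityˡ a

  ≤𝟙 : a ≤ 𝟙
  ≤𝟙 {a} = a ′ , ′-sum a

  orthogonal⇒ : a ⊕ b ↦ s → b ≤ (a ′)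
  orthogonal⇒ {s = s} p = s ′ , ⊕-complement p

  orthogonal⇐ : b ≤ (a ′) → Σ Carrier λ s → a ⊕ b ↦ s
  orthogonal⇐ {b} {a} (c , b⊕c) with ⊕-assocˡ b⊕c (′-sum a)
  ... | s , a⊕b , _ = s , a⊕b

  ′-antitone : a ≤ b → (b ′) ≤ (a ′)
  ′-antitone (c , a⊕c) = c , ⊕-comm (⊕-complement a⊕c)

  ′-galois : (a ′) ≤ b → (b ′) ≤ a
  ′-galois {a} h = subst (_ ≤_) (′-involutive a) (′-antitone h)

  ≤′-symmetric : a ≤ (b ′) → b ≤ (a ′)
  ≤′-symmetric {b = b} h = subst (_≤ _) (′-involutive b) (′-antitone h)

  ⊕-monoʳ-≤ : d ⊕ x ↦ dx → d ⊕ y ↦ dy → x ≤ y → dx ≤ dy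
  ⊕-monoʳ-≤ d⊕x d⊕y (k , x⊕k) with ⊕-assocˡ x⊕k d⊕y
  ... | t , d⊕x′ , t⊕k = k , subst (_⊕ k ↦ _) (⊕-functional d⊕x′ d⊕x) t⊕k

  ⊕-cancelʳ-≤ : d ⊕ x ↦ dx → d ⊕ y ↦ dy → dx ≤ dy → x ≤ y
  ⊕-cancelʳ-≤ d⊕x d⊕y (k , dx⊕k) with ⊕-assocʳ d⊕x dx⊕k
  ... | xk , x⊕k , d⊕xk = k , subst (_ ⊕ k ↦_) (⊕-cancelˡ d⊕xk d⊕y) x⊕k

module SasakiArrow {ℓ : Level} (E : LatticeEffectAlgebra ℓ) where
  open LatticeEffectAlgebra E
  open EffectAlgebraProperties effectAlgebra public

  private
    variable
      a b c d x y s dx dy : Carrier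

  ⊓-eqˡ : x ≤ y → x ⊓ y ≡ x
  ⊓-eqˡ {x} {y} h = ≤-antisym (⊓-lb₁ x y) (⊓-glb x y x ≤-refl h)

  ⊓-eqʳ : y ≤ x → x ⊓ y ≡ y
  ⊓-eqʳ {y} {x} h = ≤-antisym (⊓-lb₂ x y) (⊓-glb x y y h ≤-refl)

  ⊓-monoʳ-≤ : y ≤ c → (x ⊓ y) ≤ (x ⊓ c)
  ⊓-monoʳ-≤ {y} {c} {x} h = ⊓-glb x c (x ⊓ y) (⊓-lb₁ x y) (≤-trans (⊓-lb₂ x y) h)

  -- A translation by d is an order isomorphism of [𝟘, d′] onto [d, 𝟙],
  -- hence it preserves meets: d ⊕ (x ⊓ y) = (d ⊕ x) ⊓ (d ⊕ y).
  ⊕-distrib-⊓ : d ⊕ x ↦ dx → d ⊕ y ↦ dy → d ⊕ (x ⊓ y) ↦ (dx ⊓ dy)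
  ⊕-distrib-⊓ {d} {x} {dx} {y} {dy} d⊕x d⊕y
    with orthogonal⇐ (≤-trans (⊓-lb₁ x y) (orthogonal⇒ d⊕x))
       | ⊓-glb dx dy d (x , d⊕x) (y , d⊕y)
  ... | z , d⊕x⊓y | w , d⊕w = subst (d ⊕ (x ⊓ y) ↦_) (≤-antisym z≤m m≤z) d⊕x⊓y
    where
    z≤m : z ≤ (dx ⊓ dy)
    z≤m = ⊓-glb dx dy z (⊕-monoʳ-≤ d⊕x⊓y d⊕x (⊓-lb₁ x y))
                        (⊕-monoʳ-≤ d⊕x⊓y d⊕y (⊓-lb₂ x y))
    m≤z : (dx ⊓ dy) ≤ z
    m≤z = ⊕-monoʳ-≤ d⊕w d⊕x⊓y
            (⊓-glb x y w (⊕-cancelʳ-≤ d⊕w d⊕x (⊓-lb₁ dx dy))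
                         (⊕-cancelʳ-≤ d⊕w d⊕y (⊓-lb₂ dx dy)))

  -- The Sasaki arrow is always defined, since a ⊓ b ≤ a = a′′.
  -- The witness is irrelevant, so it is kept abstract and never unfolded.
  abstract
    sasaki-defined : ∀ a b → Σ Carrier λ c → a ′ ⊕ (a ⊓ b) ↦ c
    sasaki-defined a b =
      orthogonal⇐ (subst ((a ⊓ b) ≤_) (sym (′-involutive a)) (⊓-lb₁ a b))

  infixr 5 _⇛_

  _⇛_ : Carrier → Carrier → Carrier
  a ⇛ b = proj₁ (sasaki-defined a b)

  ⇛-sum : ∀ a b → a ′ ⊕ (a ⊓ b) ↦ a ⇛ b
  ⇛-sum a b = proj₂ (sasaki-defined a b)

  ⇛-unique : a ′ ⊕ (a ⊓ b) ↦ c → a ⇛ b ≡ c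
  ⇛-unique {a} {b} = ⊕-functional (⇛-sum a b)

  ′⇛-sum : ∀ a b → a ⊕ ((a ′) ⊓ b) ↦ a ′ ⇛ b
  ′⇛-sum a b = subst (λ z → z ⊕ ((a ′) ⊓ b) ↦ a ′ ⇛ b) (′-involutive a) (⇛-sum (a ′) b)

  ≤⇒⇛≡𝟙 : a ≤ b → a ⇛ b ≡ 𝟙
  ≤⇒⇛≡𝟙 {a} h = ⇛-unique (subst (λ z → a ′ ⊕ z ↦ 𝟙) (sym (⊓-eqˡ h)) (⊕-comm (′-sum a)))

  ⇛≡𝟙⇒≤ : a ⇛ b ≡ 𝟙 → a ≤ b
  ⇛≡𝟙⇒≤ {a} {b} e = subst (_≤ b) a⊓b≡a (⊓-lb₂ a b)
    where
    a⊓b≡a : a ⊓ b ≡ a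
    a⊓b≡a = trans (′-unique (a ′) (a ⊓ b) (subst (_ ⊕ _ ↦_) e (⇛-sum a b)))
                  (′-involutive a)

  ′≤⇛ : (a ′) ≤ (a ⇛ b)
  ′≤⇛ {a} {b} = a ⊓ b , ⇛-sum a b

  ⇛-monoʳ-≤ : y ≤ c → (x ⇛ y) ≤ (x ⇛ c)
  ⇛-monoʳ-≤ {y} {c} {x} h = ⊕-monoʳ-≤ (⇛-sum x y) (⇛-sum x c) (⊓-monoʳ-≤ h)

  ⊕-as-⇛ : b ≤ (a ′) → a ⊕ b ↦ a ′ ⇛ b
  ⊕-as-⇛ {b} {a} h = subst (λ z → a ⊕ z ↦ a ′ ⇛ b) (⊓-eqʳ h) (′⇛-sum a b)

  infix 25 ∼_

  ∼_ : Carrier → Carrier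
  ∼ a = a ⇛ 𝟘

  ∼≡′ : ∀ a → ∼ a ≡ a ′
  ∼≡′ a = ⇛-unique (subst (λ z → a ′ ⊕ z ↦ a ′) (sym (⊓-eqʳ 𝟘≤)) (⊕-identityʳ (a ′)))

  ∼-involutive : ∀ a → ∼ ∼ a ≡ a
  ∼-involutive a = trans (∼≡′ (∼ a)) (trans (cong _′ (∼≡′ a)) (′-involutive a))

  ∼𝟘≡𝟙 : ∼ 𝟘 ≡ 𝟙
  ∼𝟘≡𝟙 = trans (∼≡′ 𝟘) 𝟘′≡𝟙

  ∼-antitone : a ≤ b → ∼ b ≤ ∼ a
  ∼-antitone {a} {b} h = subst₂ _≤_ (sym (∼≡′ b)) (sym (∼≡′ a)) (′-antitone h)

  infix 6 _⊙_ _⋏_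

  _⊙_ : Carrier → Carrier → Carrier
  a ⊙ b = ∼ (a ⇛ ∼ b)

  _⋏_ : Carrier → Carrier → Carrier
  a ⋏ b = a ⊙ (a ⇛ b)

  -- a ⊙ b = (a ⇛ ∼ b)′ ≤ a′′ = a.
  ⊙≤ˡ : (a ⊙ b) ≤ a
  ⊙≤ˡ {a} {b} = subst₂ _≤_ (sym (∼≡′ _)) (′-involutive a) (′-antitone ′≤⇛)

  ⊙-as-⊕ : (a ′) ≤ b → a ′ ⊕ b ′ ↦ s → a ⊙ b ≡ s ′
  ⊙-as-⊕ {a} {b} {s} h p = begin
    ∼ (a ⇛ ∼ b)     ≡⟨ ∼≡′ _ ⟩
    (a ⇛ ∼ b) ′     ≡⟨ cong (λ z → (a ⇛ z) ′) (∼≡′ b) ⟩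
    (a ⇛ b ′) ′     ≡⟨ cong _′ (⇛-unique a′⊕a⊓b′) ⟩
    s ′             ∎
    where
    open ≡-Reasoning
    a′⊕a⊓b′ : a ′ ⊕ (a ⊓ (b ′)) ↦ s
    a′⊕a⊓b′ = subst (λ z → a ′ ⊕ z ↦ s) (sym (⊓-eqʳ (′-galois h))) p

  -- a ∧ b is interpreted by the lattice meet: a ′ ⊕ (a ⇛ b)′ ⊕ (a ⊓ b) = 𝟙.
  ⋏≡⊓ : ∀ a b → a ⋏ b ≡ a ⊓ b
  ⋏≡⊓ a b = via-t (⊕-assocˡ (⊕-comm a⊓b⊕v′) (⊕-comm (′-sum a)))
    where
    a⊓b⊕v′ : (a ⊓ b) ⊕ (a ⇛ b) ′ ↦ a
    a⊓b⊕v′ = subst ((a ⊓ b) ⊕ (a ⇛ b) ′ ↦_) (′-involutive a) (⊕-complement (⇛-sum a b))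
    via-t : (Σ Carrier λ t → a ′ ⊕ (a ⇛ b) ′ ↦ t × t ⊕ (a ⊓ b) ↦ 𝟙) → a ⋏ b ≡ a ⊓ b
    via-t (t , a′⊕v′ , t⊕a⊓b) =
      trans (⊙-as-⊕ ′≤⇛ a′⊕v′) (sym (′-unique t (a ⊓ b) t⊕a⊓b))

  -- With a ⊕ d = b, both sides equal b ⊕ (b′ ⊓ a) = a ⊕ d ⊕ (b′ ⊓ a),
  -- because translation by d maps a ⊓ b′ to b ⊓ a′.
  ′⇛-swap : a ≤ b → a ′ ⇛ b ≡ b ′ ⇛ a
  ′⇛-swap {a} {b} (d , a⊕d) = via-b (⊕-assocˡ d⊕b′⊓a (′⇛-sum a b))
    where
    d⊕b′⊓a : d ⊕ ((b ′) ⊓ a) ↦ ((a ′) ⊓ b)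
    d⊕b′⊓a = ⊕-distrib-⊓ (⊕-complement a⊕d) (⊕-comm a⊕d)
    via-b : (Σ Carrier λ t → a ⊕ d ↦ t × t ⊕ ((b ′) ⊓ a) ↦ a ′ ⇛ b) → a ′ ⇛ b ≡ b ′ ⇛ a
    via-b (t , a⊕d′ , t⊕b′⊓a) =
      ⊕-functional (subst (λ z → z ⊕ ((b ′) ⊓ a) ↦ a ′ ⇛ b) (⊕-functional a⊕d′ a⊕d) t⊕b′⊓a)
                   (′⇛-sum b a)

  ∼⇛-swap : a ≤ b → ∼ a ⇛ b ≡ ∼ b ⇛ a
  ∼⇛-swap {a} {b} h = begin
    ∼ a ⇛ b     ≡⟨ cong (_⇛ b) (∼≡′ a) ⟩
    a ′ ⇛ b     ≡⟨ ′⇛-swap h ⟩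
    b ′ ⇛ a     ≡⟨ cong (_⇛ a) (sym (∼≡′ b)) ⟩
    ∼ b ⇛ a     ∎
    where open ≡-Reasoning

  -- (R5), which holds even without its premise: a = (∼ a)′ ≤ ∼ a ⇛ b.
  ≤∼⇛ : a ≤ (∼ a ⇛ b)
  ≤∼⇛ {a} {b} = subst (_≤ (∼ a ⇛ b)) ∼a′≡a ′≤⇛
    where
    ∼a′≡a : (∼ a) ′ ≡ a
    ∼a′≡a = trans (cong _′ (∼≡′ a)) (′-involutive a)

  ⊙-monoʳ-≤ : a ≤ b → (c ⊙ a) ≤ (c ⊙ b)
  ⊙-monoʳ-≤ h = ∼-antitone (⇛-monoʳ-≤ (∼-antitone h))

  -- If b, c ≤ a′ and (a ⊕ b) ⊕ c is defined, then so is (a ⊕ c) ⊕ b,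
  -- by associativity of ⊕.
  ′⇛-exchange : a ≤ (b ′) → a ≤ (c ′) → (a ′ ⇛ b) ≤ (c ′) → (a ′ ⇛ c) ≤ (b ′)
  ′⇛-exchange {a} {b} {c} hb hc h = via-c⊕u (orthogonal⇐ h)
    where
    a⊕b : a ⊕ b ↦ a ′ ⇛ b
    a⊕b = ⊕-as-⇛ (≤′-symmetric hb)
    a⊕c : a ⊕ c ↦ a ′ ⇛ c
    a⊕c = ⊕-as-⇛ (≤′-symmetric hc)
    via-a⊕c : ∀ {s} → (Σ Carrier λ t → a ⊕ c ↦ t × b ⊕ t ↦ s) → (a ′ ⇛ c) ≤ (b ′)
    via-a⊕c {s} (t , a⊕c′ , b⊕t) =
      orthogonal⇒ (subst (λ z → b ⊕ z ↦ s) (⊕-functional a⊕c′ a⊕c) b⊕t)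
    via-c⊕u : (Σ Carrier λ s → c ⊕ (a ′ ⇛ b) ↦ s) → (a ′ ⇛ c) ≤ (b ′)
    via-c⊕u (s , c⊕u) = via-a⊕c (⊕-assocʳ (⊕-comm a⊕b) (⊕-comm c⊕u))

  ⇛-exchange : a ≤ ∼ b → a ≤ ∼ c → (∼ a ⇛ b) ≤ ∼ c → (∼ a ⇛ c) ≤ ∼ b
  ⇛-exchange {a} {b} {c} hb hc h =
    subst₂ _≤_ (cong (_⇛ c) (sym (∼≡′ a))) (sym (∼≡′ b))
      (′⇛-exchange (subst (a ≤_) (∼≡′ b) hb) (subst (a ≤_) (∼≡′ c) hc)
                   (subst₂ _≤_ (cong (_⇛ b) (∼≡′ a)) (∼≡′ c) h))

  -- Under the hypotheses a′ ⊕ b′ ⊕ c′ is defined and all four products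
  -- are orthosupplements of partial sums of it, so associativity of ⊙
  -- reduces to (E2).
  ′⊙-assoc : (b ′) ≤ c → (a ′) ≤ (b ⊙ c) → a ⊙ (b ⊙ c) ≡ (a ⊙ b) ⊙ c
  ′⊙-assoc {b} {c} {a} h₁ h₂ = via-p (orthogonal⇐ (′-antitone h₁))
    where
    via-r : ∀ {p q} → b ′ ⊕ c ′ ↦ p → p ⊕ a ′ ↦ q →
            (Σ Carrier λ r → a ′ ⊕ b ′ ↦ r × r ⊕ c ′ ↦ q) →
            a ⊙ (b ⊙ c) ≡ (a ⊙ b) ⊙ c
    via-r {p} {q} b′⊕c′ p⊕a′ (r , a′⊕b′ , r⊕c′) = trans left (sym right)
      where
      bc′≡p : (b ⊙ c) ′ ≡ p
      bc′≡p = trans (cong _′ (⊙-as-⊕ h₁ b′⊕c′)) (′-involutive p)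
      ab′≡r : (a ⊙ b) ′ ≡ r
      ab′≡r = trans (cong _′ (⊙-as-⊕ (≤-trans h₂ ⊙≤ˡ) a′⊕b′)) (′-involutive r)
      left : a ⊙ (b ⊙ c) ≡ q ′
      left = ⊙-as-⊕ h₂ (subst (λ z → a ′ ⊕ z ↦ q) (sym bc′≡p) (⊕-comm p⊕a′))
      right : (a ⊙ b) ⊙ c ≡ q ′
      right = ⊙-as-⊕ (subst₂ _≤_ (sym ab′≡r) (′-involutive c) (orthogonal⇒ (⊕-comm r⊕c′)))
                     (subst (λ z → z ⊕ c ′ ↦ q) (sym ab′≡r) r⊕c′)
    via-q : ∀ {p} → b ′ ⊕ c ′ ↦ p → (Σ Carrier λ q → p ⊕ a ′ ↦ q) →
            a ⊙ (b ⊙ c) ≡ (a ⊙ b) ⊙ c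
    via-q b′⊕c′ (q , p⊕a′) = via-r b′⊕c′ p⊕a′ (⊕-assocˡ b′⊕c′ (⊕-comm p⊕a′))
    via-p : (Σ Carrier λ p → b ′ ⊕ c ′ ↦ p) → a ⊙ (b ⊙ c) ≡ (a ⊙ b) ⊙ c
    via-p (p , b′⊕c′) =
      via-q b′⊕c′ (orthogonal⇐ (subst ((a ′) ≤_) (⊙-as-⊕ h₁ b′⊕c′) h₂))

  ⊙-assoc : ∼ b ≤ c → ∼ a ≤ (b ⊙ c) → a ⊙ (b ⊙ c) ≡ (a ⊙ b) ⊙ c
  ⊙-assoc {b} {c} {a} h₁ h₂ =
    ′⊙-assoc (subst (_≤ c) (∼≡′ b) h₁) (subst (_≤ (b ⊙ c)) (∼≡′ a) h₂)

module Semantics {ℓ p : Level} {P : Set p} (E : LatticeEffectAlgebra ℓ)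
                 (V : P → LatticeEffectAlgebra.Carrier E) where
  open LatticeEffectAlgebra E using (Carrier; 𝟙; 𝟘; _≤_; ⊓-lb₁; ⊓-lb₂; ⊓-glb)
  open SasakiArrow E

  eval : Formula P → Carrier
  eval (atom x) = V x
  eval ⊥f       = 𝟘
  eval (φ ⇒ ψ)  = eval φ ⇛ eval ψ

  eval-agrees : ∀ φ → ⟦_⟧ E φ V ≡ just (eval φ)
  eval-agrees (atom x) = refl
  eval-agrees ⊥f = refl
  eval-agrees (φ ⇒ ψ) rewrite eval-agrees φ | eval-agrees ψ = ⇛-sum (eval φ) (eval ψ)

  sound : ∀ {φ} → ⊢ φ → eval φ ≡ 𝟙
  sound-⇒ : ∀ {φ ψ} → ⊢ φ ⇒ ψ → eval φ ≤ eval ψ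
  sound-⇒ d = ⇛≡𝟙⇒≤ (sound d)

  sound (A1 φ) = ≤⇒⇛≡𝟙 ≤-refl
  sound (A2a φ) = ≤⇒⇛≡𝟙 (≡⇒≤ (sym (∼-involutive (eval φ))))
  sound (A2b φ) = ≤⇒⇛≡𝟙 (≡⇒≤ (∼-involutive (eval φ)))
  sound (A3 φ) = ≤⇒⇛≡𝟙 (subst (eval φ ≤_) (sym ∼𝟘≡𝟙) ≤𝟙)
  sound (A4 φ ψ) = ≤⇒⇛≡𝟙 (subst (_≤ _) (sym (⋏≡⊓ (eval φ) (eval ψ))) (⊓-lb₁ _ _))
  sound (A5 φ ψ) = ≤⇒⇛≡𝟙 (subst (_≤ _) (sym (⋏≡⊓ (eval φ) (eval ψ))) (⊓-lb₂ _ _))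
  sound (R1a d) = ≤⇒⇛≡𝟙 (≡⇒≤ (trans ∼𝟘≡𝟙 (sym (sound d))))
  sound (R1b {φ} d) = ≤-antisym ≤𝟙 (subst (_≤ eval φ) ∼𝟘≡𝟙 (sound-⇒ d))
  sound (R2 d e) = ≤⇒⇛≡𝟙 (≤-trans (sound-⇒ d) (sound-⇒ e))
  sound (R3 d) = ≤⇒⇛≡𝟙 (∼-antitone (sound-⇒ d))
  sound (R4a d) = ≤⇒⇛≡𝟙 (≡⇒≤ (∼⇛-swap (sound-⇒ d)))
  sound (R4b d) = ≤⇒⇛≡𝟙 (≡⇒≤ (sym (∼⇛-swap (sound-⇒ d))))
  sound (R5 d) = ≤⇒⇛≡𝟙 ≤∼⇛
  sound (R6 χ d) = ≤⇒⇛≡𝟙 (⊙-monoʳ-≤ (sound-⇒ d))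
  sound (R7a χ d e) = ≤⇒⇛≡𝟙 (≡⇒≤ (cong (_⊙ eval χ) (≤-antisym (sound-⇒ d) (sound-⇒ e))))
  sound (R7b χ d e) = ≤⇒⇛≡𝟙 (≡⇒≤ (cong (_⊙ eval χ) (≤-antisym (sound-⇒ e) (sound-⇒ d))))
  sound (R8 {φ} {ψ} {χ} d e) =
    ≤⇒⇛≡𝟙 (subst (_ ≤_) (sym (⋏≡⊓ (eval ψ) (eval χ)))
              (⊓-glb (eval ψ) (eval χ) (eval φ) (sound-⇒ d) (sound-⇒ e)))
  sound (R9 d e f) = ≤⇒⇛≡𝟙 (⇛-exchange (sound-⇒ d) (sound-⇒ e) (sound-⇒ f))
  sound (R10a d e) = ≤⇒⇛≡𝟙 (≡⇒≤ (⊙-assoc (sound-⇒ d) (sound-⇒ e)))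
  sound (R10b d e) = ≤⇒⇛≡𝟙 (≡⇒≤ (sym (⊙-assoc (sound-⇒ d) (sound-⇒ e))))

mainTheorem7 : ∀ {p ℓ : Level} {P : Set p} (φ : Formula P) → ⊢ φ →
    (E : LatticeEffectAlgebra ℓ)
    (V : P → LatticeEffectAlgebra.Carrier E) → ValidIn E φ V
mainTheorem7 φ d E V = trans (eval-agrees φ) (cong just (sound d))
  where open Semantics E V
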